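{- Let $C$ be a cyclically ordered set and $T(C)=C\times\{0,1\}$ with the cyclic structure described below. Then $T(C)$ is a cyclically ordered set, and $\iota_C:C\to T(C)$, $c\mapsto (c,0)$, is an embedding of cyclically ordered sets. The construction $C\mapsto T(C)$, $f\mapsto T(f)$ is a functor on the category of cyclically ordered sets and embeddings, and $\iota$ is a natural transformation from the identity functor to $T$. Moreover, if $C$ is nonempty then $T(C)$ has at least two elements.
   Context: A cyclically ordered set is a set $S$ with a ternary relation $R$ satisfying: (Asymmetry) $R(x,y,z)\wedge R(x,z,w)\rightarrow y\neq w$; (Transitivity) $R(x,y,z)\wedge R(x,z,w)\rightarrow R(x,y,w)$; (Connectedness) for pairwise distinct $x,y,z$, $R(x,y,z)$ or $R(z,y,x)$; (Cyclicity) $R(x,y,z)\rightarrow R(y,z,x)$. An embedding $f:C\to D$ is an injective map with $R_C(a,b,c)\leftrightarrow R_D(f(a),f(b),f(c))$. The cyclic structure on $T(C)=C\times\{0,1\}$: $C\times\{0\}$ carries the cyclic order of $C$, and each $(c,1)$ is placed in the cut immediately after $(c,0)$; in particular $R((x,0),(x,1),y)$ holds for every $y$ distinct from $(x,0),(x,1)$. For an embedding $f:C\to D$, $T(f):T(C)\to T(D)$ is $(c,i)\mapsto(f(c),i)$. -}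

module Defs where

open import Data.Bool using (Bool; true; false)
open import Data.Product using (_×_; _,_)
open import Data.Sum using (_⊎_)
open import Relation.Binary.PropositionalEquality using (_≡_; _≢_)

record TernStr : Set₁ where
  field
    Carrier : Set
    R       : Carrier → Carrier → Carrier → Set
open TernStr public

record IsCyclicOrder (S : TernStr) : Set where
  field
    asymmetry    : ∀ {x y z w} → R S x y z → R S x z w → y ≢ w
    transitivity : ∀ {x y z w} → R S x y z → R S x z w → R S x y w
    connected    : ∀ {x y z} → x ≢ y → y ≢ z → x ≢ z → R S x y z ⊎ R S z y x
    cyclicity    : ∀ {x y z} → R S x y z → R S y z x

record CyclicOrder : Set₁ where
  field
    str : TernStr
    isCyclicOrder : IsCyclicOrder str
open CyclicOrder public

record IsEmbedding (C D : TernStr) (f : Carrier C → Carrier D) : Set where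
  field
    injective : ∀ {x y} → f x ≡ f y → x ≡ y
    preserves : ∀ {x y z} → R C x y z → R D (f x) (f y) (f z)
    reflects  : ∀ {x y z} → R D (f x) (f y) (f z) → R C x y z

-- T(C) = C × {0,1}, with 0 = false, 1 = true.
-- C × {0} carries the order of C; (c,1) sits in the cut immediately after (c,0).
TR : (S : TernStr) → Carrier S × Bool → Carrier S × Bool → Carrier S × Bool → Set
TR S (a , i) (b , j) (c , k) =
    R S a b c
  ⊎ ((a ≡ b × i ≡ false × j ≡ true × c ≢ a)
  ⊎ ((b ≡ c × j ≡ false × k ≡ true × a ≢ b)
  ⊎ (c ≡ a × k ≡ false × i ≡ true × b ≢ c)))

T : TernStr → TernStr
T S = record { Carrier = Carrier S × Bool ; R = TR S }

ι : (S : TernStr) → Carrier S → Carrier (T S)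
ι S c = (c , false)

Tmap : {S S′ : TernStr} → (Carrier S → Carrier S′) → Carrier (T S) → Carrier (T S′)
Tmap f (c , i) = (f c , i)

{-# OPTIONS --safe #-}
-- T(C) splits every point c of C into two adjacent points (c,0), (c,1) with nothing
-- between them. A triple of T(C) over three distinct points of C is ordered as in C,
-- and a triple over two points of C is ordered by where the split point lies, so
-- each axiom for T(C) is the corresponding axiom for C plus a case analysis on which
-- coordinates coincide. Only connectedness uses excluded middle: telling those cases
-- apart means deciding equality in C.
module Submission where

open import Defs
open import Data.Bool using (Bool; true; false)
open import Data.Empty using (⊥; ⊥-elim)
open import Data.Product using (_×_; _,_; ∃₂; proj₁; proj₂)
open import Data.Sum using (_⊎_; inj₁; inj₂)
import Data.Sum as Sum
open import Function using (id; _∘_)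
open import Relation.Binary.Definitions using (DecidableEquality)
open import Relation.Nullary using (¬_; yes; no)
open import Relation.Nullary.Decidable using (fromSum)
open import Relation.Binary.PropositionalEquality using (_≡_; _≢_; refl; cong; ≢-sym)

-- The disjuncts of TR: the order of C, or the split point (a,0),(a,1) in positions 1–2, 2–3 or 3–1.
pattern base r = inj₁ r
pattern cut₁₂ p = inj₂ (inj₁ p)
pattern cut₂₃ p = inj₂ (inj₂ (inj₁ p))
pattern cut₃₁ p = inj₂ (inj₂ (inj₂ p))

no-three-distinct-Bool : ∀ {A : Set} {a : A} (i j k : Bool) →
  (a , i) ≢ (a , j) → (a , j) ≢ (a , k) → (a , i) ≢ (a , k) → ⊥
no-three-distinct-Bool false false _     x≢y _   _   = x≢y refl
no-three-distinct-Bool true  true  _     x≢y _   _   = x≢y refl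
no-three-distinct-Bool false true  false _   _   x≢z = x≢z refl
no-three-distinct-Bool false true  true  _   y≢z _   = y≢z refl
no-three-distinct-Bool true  false false _   y≢z _   = y≢z refl
no-three-distinct-Bool true  false true  _   _   x≢z = x≢z refl

module _ {S : TernStr} (cyclic : IsCyclicOrder S) where
  open IsCyclicOrder cyclic

  R⇒y≢z : ∀ {x y z} → R S x y z → y ≢ z
  R⇒y≢z r refl = asymmetry r r refl

  R⇒x≢z : ∀ {x y z} → R S x y z → x ≢ z
  R⇒x≢z r refl = R⇒y≢z (cyclicity r) refl

  R⇒x≢y : ∀ {x y z} → R S x y z → x ≢ y
  R⇒x≢y r refl = R⇒y≢z (cyclicity (cyclicity r)) refl

  TR-cyclicity : ∀ {x y z} → TR S x y z → TR S y z x
  TR-cyclicity (base r)  = base (cyclicity r)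
  TR-cyclicity (cut₁₂ p) = cut₃₁ p
  TR-cyclicity (cut₂₃ p) = cut₁₂ p
  TR-cyclicity (cut₃₁ p) = cut₂₃ p

  TR-transitivity : ∀ {x y z w} → TR S x y z → TR S x z w → TR S x y w
  TR-transitivity (base r) (base r′) = base (transitivity r r′)
  TR-transitivity (base r) (cut₁₂ (refl , _)) = ⊥-elim (R⇒x≢z r refl)
  TR-transitivity (base r) (cut₂₃ (refl , _)) = base r
  TR-transitivity (base r) (cut₃₁ (refl , refl , refl , _)) =
    cut₃₁ (refl , refl , refl , ≢-sym (R⇒x≢y r))
  TR-transitivity (cut₁₂ (refl , refl , refl , _)) (base r′) =
    cut₁₂ (refl , refl , refl , ≢-sym (R⇒x≢z r′))
  TR-transitivity (cut₁₂ (refl , _ , _ , z≢x)) (cut₁₂ (refl , _)) = ⊥-elim (z≢x refl)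
  TR-transitivity (cut₁₂ (refl , refl , refl , z≢x)) (cut₂₃ (refl , _)) =
    cut₁₂ (refl , refl , refl , z≢x)
  TR-transitivity (cut₁₂ (refl , refl , _ , _)) (cut₃₁ (_ , _ , () , _))
  TR-transitivity (cut₂₃ (refl , _)) (base r′) = base r′
  TR-transitivity (cut₂₃ (refl , _ , _ , x≢y)) (cut₁₂ (refl , _)) = ⊥-elim (x≢y refl)
  TR-transitivity (cut₂₃ (_ , _ , refl , _)) (cut₂₃ (_ , () , _))
  TR-transitivity (cut₂₃ (refl , refl , refl , x≢y)) (cut₃₁ (refl , refl , refl , _)) =
    cut₃₁ (refl , refl , refl , ≢-sym x≢y)
  TR-transitivity (cut₃₁ (refl , _)) (base r′) = ⊥-elim (R⇒x≢y r′ refl)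
  TR-transitivity (cut₃₁ (_ , refl , _)) (cut₁₂ (_ , _ , () , _))
  TR-transitivity (cut₃₁ (refl , _)) (cut₂₃ (refl , _ , _ , x≢z)) = ⊥-elim (x≢z refl)
  TR-transitivity (cut₃₁ (refl , refl , refl , y≢z)) (cut₃₁ (refl , refl , refl , _)) =
    cut₃₁ (refl , refl , refl , y≢z)

  TR-irrefl₂₃ : ∀ {x y} → ¬ TR S x y y
  TR-irrefl₂₃ (base r)                  = R⇒y≢z r refl
  TR-irrefl₂₃ (cut₁₂ (refl , _ , _ , y≢x)) = y≢x refl
  TR-irrefl₂₃ (cut₂₃ (_ , refl , ()  , _))
  TR-irrefl₂₃ (cut₃₁ (_ , _ , _ , y≢y))    = y≢y refl

  TR-asymmetry : ∀ {x y z w} → TR S x y z → TR S x z w → y ≢ w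
  TR-asymmetry t t′ refl = TR-irrefl₂₃ (TR-transitivity t t′)

  TR-connected-rotate : ∀ {x y z} → TR S y z x ⊎ TR S x z y → TR S x y z ⊎ TR S z y x
  TR-connected-rotate = Sum.map (TR-cyclicity ∘ TR-cyclicity) TR-cyclicity

  module _ (_≟_ : DecidableEquality (Carrier S)) where

    TR-connected-split : ∀ {a i j z} → (a , i) ≢ (a , j) → (a , j) ≢ z → (a , i) ≢ z →
      TR S (a , i) (a , j) z ⊎ TR S z (a , j) (a , i)
    TR-connected-split {a} {i} {j} {c , k} x≢y y≢z x≢z with c ≟ a | i | j | k
    ... | yes refl | i′    | j′    | k′ = ⊥-elim (no-three-distinct-Bool i′ j′ k′ x≢y y≢z x≢z)
    ... | no c≢a   | false | true  | _  = inj₁ (cut₁₂ (refl , refl , refl , c≢a))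
    ... | no c≢a   | true  | false | _  = inj₂ (cut₂₃ (refl , refl , refl , c≢a))
    ... | no _     | false | false | _  = ⊥-elim (x≢y refl)
    ... | no _     | true  | true  | _  = ⊥-elim (x≢y refl)

    TR-connected : ∀ {x y z} → x ≢ y → y ≢ z → x ≢ z → TR S x y z ⊎ TR S z y x
    TR-connected {a , i} {b , j} {c , k} x≢y y≢z x≢z with a ≟ b | b ≟ c | c ≟ a
    ... | yes refl | _        | _        = TR-connected-split x≢y y≢z x≢z
    ... | _        | yes refl | _        =
      TR-connected-rotate (TR-connected-split y≢z (≢-sym x≢z) (≢-sym x≢y))
    ... | _        | _        | yes refl =
      TR-connected-rotate (TR-connected-rotate
        (TR-connected-split (≢-sym x≢z) x≢y (≢-sym y≢z)))
    ... | no a≢b   | no b≢c   | no c≢a   =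
      Sum.map base base (connected a≢b b≢c (≢-sym c≢a))

    T-isCyclicOrder : IsCyclicOrder (T S)
    T-isCyclicOrder = record
      { asymmetry    = TR-asymmetry
      ; transitivity = TR-transitivity
      ; connected    = TR-connected
      ; cyclicity    = TR-cyclicity
      }

ι-isEmbedding : (S : TernStr) → IsEmbedding S (T S) (ι S)
ι-isEmbedding S = record
  { injective = λ { refl → refl }
  ; preserves = base
  ; reflects  = reflects
  }
  where
  reflects : ∀ {x y z} → TR S (ι S x) (ι S y) (ι S z) → R S x y z
  reflects (base r)               = r
  reflects (cut₁₂ (_ , _ , () , _))
  reflects (cut₂₃ (_ , _ , () , _))
  reflects (cut₃₁ (_ , _ , () , _))

module _ {S S′ : TernStr} {f : Carrier S → Carrier S′} (emb : IsEmbedding S S′ f) where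
  open IsEmbedding emb

  map-cut : ∀ {a b c} {i j : Bool} →
    a ≡ b × i ≡ false × j ≡ true × c ≢ a → f a ≡ f b × i ≡ false × j ≡ true × f c ≢ f a
  map-cut (a≡b , i≡0 , j≡1 , c≢a) = cong f a≡b , i≡0 , j≡1 , c≢a ∘ injective

  unmap-cut : ∀ {a b c} {i j : Bool} →
    f a ≡ f b × i ≡ false × j ≡ true × f c ≢ f a → a ≡ b × i ≡ false × j ≡ true × c ≢ a
  unmap-cut (fa≡fb , i≡0 , j≡1 , fc≢fa) = injective fa≡fb , i≡0 , j≡1 , fc≢fa ∘ cong f

  Tmap-injective : ∀ {x y} → Tmap {S} {S′} f x ≡ Tmap {S} {S′} f y → x ≡ y
  Tmap-injective {a , i} {b , j} fx≡fy with injective (cong proj₁ fx≡fy) | cong proj₂ fx≡fy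
  ... | refl | refl = refl

  Tmap-preserves : ∀ {x y z} → TR S x y z →
    TR S′ (Tmap {S} {S′} f x) (Tmap {S} {S′} f y) (Tmap {S} {S′} f z)
  Tmap-preserves (base r)  = base (preserves r)
  Tmap-preserves (cut₁₂ p) = cut₁₂ (map-cut p)
  Tmap-preserves (cut₂₃ p) = cut₂₃ (map-cut p)
  Tmap-preserves (cut₃₁ p) = cut₃₁ (map-cut p)

  Tmap-reflects : ∀ {x y z} →
    TR S′ (Tmap {S} {S′} f x) (Tmap {S} {S′} f y) (Tmap {S} {S′} f z) → TR S x y z
  Tmap-reflects (base r)  = base (reflects r)
  Tmap-reflects (cut₁₂ p) = cut₁₂ (unmap-cut p)
  Tmap-reflects (cut₂₃ p) = cut₂₃ (unmap-cut p)
  Tmap-reflects (cut₃₁ p) = cut₃₁ (unmap-cut p)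

  Tmap-isEmbedding : IsEmbedding (T S) (T S′) (Tmap {S} {S′} f)
  Tmap-isEmbedding = record
    { injective = Tmap-injective
    ; preserves = Tmap-preserves
    ; reflects  = Tmap-reflects
    }

Tmap-id : ∀ {S : TernStr} (x : Carrier (T S)) → Tmap {S} {S} id x ≡ x
Tmap-id _ = refl

Tmap-∘ : ∀ {S S′ S″ : TernStr} (f : Carrier S → Carrier S′) (g : Carrier S′ → Carrier S″)
  (x : Carrier (T S)) → Tmap {S} {S″} (g ∘ f) x ≡ Tmap {S′} {S″} g (Tmap {S} {S′} f x)
Tmap-∘ _ _ _ = refl

Tmap-ι : ∀ {S S′ : TernStr} (f : Carrier S → Carrier S′) (c : Carrier S) →
  Tmap {S} {S′} f (ι S c) ≡ ι S′ (f c)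
Tmap-ι _ _ = refl

ι≢split : ∀ {S : TernStr} (c : Carrier S) → ι S c ≢ (c , true)
ι≢split _ ()

lemma3p4 : ((P : Set) → P ⊎ ¬ P) →
    ((C : CyclicOrder) → IsCyclicOrder (T (str C)))
    × ((C : CyclicOrder) → IsEmbedding (str C) (T (str C)) (ι (str C)))
    × ((C D : CyclicOrder) (f : Carrier (str C) → Carrier (str D)) →
         IsEmbedding (str C) (str D) f →
         IsEmbedding (T (str C)) (T (str D)) (Tmap {str C} {str D} f))
    × ((C : CyclicOrder) (x : Carrier (T (str C))) →
         Tmap {str C} {str C} id x ≡ x)
    × ((C D E : CyclicOrder)
       (f : Carrier (str C) → Carrier (str D)) (g : Carrier (str D) → Carrier (str E)) →
         IsEmbedding (str C) (str D) f → IsEmbedding (str D) (str E) g →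
         (x : Carrier (T (str C))) →
         Tmap {str C} {str E} (g ∘ f) x ≡ Tmap {str D} {str E} g (Tmap {str C} {str D} f x))
    × ((C D : CyclicOrder) (f : Carrier (str C) → Carrier (str D)) →
         IsEmbedding (str C) (str D) f →
         (c : Carrier (str C)) →
         Tmap {str C} {str D} f (ι (str C) c) ≡ ι (str D) (f c))
    × ((C : CyclicOrder) → Carrier (str C) →
         ∃₂ λ (x y : Carrier (T (str C))) → x ≢ y)
lemma3p4 excluded-middle =
    (λ C → T-isCyclicOrder (isCyclicOrder C) (λ a b → fromSum (excluded-middle (a ≡ b))))
  , (λ C → ι-isEmbedding (str C))
  , (λ _ _ _ → Tmap-isEmbedding)
  , (λ C → Tmap-id {str C})
  , (λ C D E f g _ _ → Tmap-∘ {str C} {str D} {str E} f g)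
  , (λ C D f _ → Tmap-ι {str C} {str D} f)
  , (λ C c → ι (str C) c , (c , true) , ι≢split {str C} c)
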